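{- Let $P$ be a lattice polytope cut out by a root system $\Phi$ each of whose irreducible summands is of type $A$, $B$, $C$, or $D$. Then $P$ is diagonally split for all odd integers $q \ge 3$.
   Context: For a root system $\Phi$ with root lattice $N$ (generated by the roots), let $M = \mathrm{Hom}(N,\mathbb{Z})$ and $M_{\mathbb{R}} = M \otimes \mathbb{R}$. A polytope $P\subset M_{\mathbb{R}}$ is cut out by $\Phi$ if each facet normal is spanned by a root; it is a lattice polytope if its vertices lie in $M$. For a lattice polytope $P$ with primitive inward facet normals $v_1,\dots,v_s \in N$, the diagonal splitting polytope is $\mathbb{F}_P = \{u \in M_{\mathbb{R}} : -1 \le \langle u, v_i\rangle \le 1 \text{ for } 1 \le i \le s\}$. For an integer $q \ge 2$, $P$ is diagonally split for $q$ if the interior of $\mathbb{F}_P$ contains representatives of every equivalence class in $\frac{1}{q}M/M$. -}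

module Defs where

open import Data.Nat as ℕ using (ℕ; zero; suc; _≤_; NonZero)
open import Data.Integer as ℤ using (ℤ; +_; -[1+_])
open import Data.Integer.Divisibility using () renaming (_∣_ to _∣ℤ_)
open import Data.Rational as ℚ using (ℚ)
open import Data.Fin using (Fin; toℕ; _↑ˡ_; _↑ʳ_) renaming (zero to fzero; suc to fsuc)
open import Data.Fin.Properties using () renaming (_≟_ to _≟ᶠ_)
open import Data.List using (List; []; _∷_)
open import Data.List.Membership.Propositional using (_∈_)
open import Data.Product using (Σ; _×_; ∃; ∃-syntax)
open import Data.Sum using (_⊎_)
open import Data.Empty using (⊥)
open import Data.Unit using (⊤)
open import Data.Bool using (if_then_else_)
open import Relation.Nullary using (¬_)
open import Relation.Nullary.Decidable using (⌊_⌋)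
open import Relation.Binary.PropositionalEquality using (_≡_; _≢_)
open import Function using (_∘_)

sumℤ : ∀ {n} → (Fin n → ℤ) → ℤ
sumℤ {zero}  f = + 0
sumℤ {suc n} f = f fzero ℤ.+ sumℤ (f ∘ fsuc)

sumℚ : ∀ {n} → (Fin n → ℚ) → ℚ
sumℚ {zero}  f = ℚ.0ℚ
sumℚ {suc n} f = f fzero ℚ.+ sumℚ (f ∘ fsuc)

-- pairing ℤ^n × ℤ^n → ℤ  (M × N → ℤ in dual bases)
⟪_,_⟫ : ∀ {n} → (Fin n → ℤ) → (Fin n → ℤ) → ℤ
⟪ u , v ⟫ = sumℤ (λ j → u j ℤ.* v j)

ι : ℤ → ℚ
ι z = z ℚ./ 1

⟪_,_⟫ℚ : ∀ {n} → (Fin n → ℚ) → (Fin n → ℤ) → ℚ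
⟪ u , v ⟫ℚ = sumℚ (λ j → u j ℚ.* ι (v j))

data RootType : Set where
  A B C D : ℕ → RootType

ValidType : RootType → Set
ValidType (A r) = 1 ≤ r
ValidType (B r) = 2 ≤ r
ValidType (C r) = 3 ≤ r
ValidType (D r) = 4 ≤ r

rankT : RootType → ℕ
rankT (A r) = r
rankT (B r) = r
rankT (C r) = r
rankT (D r) = r

-- dimension of the ambient Euclidean model
ambT : RootType → ℕ
ambT (A r) = suc r
ambT (B r) = r
ambT (C r) = r
ambT (D r) = r

δ : ℕ → ℕ → ℤ
δ a b = if ⌊ a ℕ.≟ b ⌋ then + 1 else + 0

e : ∀ {m} → Fin m → Fin m → ℤ
e i j = if ⌊ i ≟ᶠ j ⌋ then + 1 else + 0

-- simple roots α_k (k : Fin (rankT t)) in the ambient model, 0-indexed: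
--   A_r : α_k = e_k - e_{k+1}  in ℤ^{r+1}
--   B_r : α_k = e_k - e_{k+1} (k < r-1),  α_{r-1} = e_{r-1}
--   C_r : α_k = e_k - e_{k+1} (k < r-1),  α_{r-1} = 2 e_{r-1}
--   D_r : α_k = e_k - e_{k+1} (k < r-1),  α_{r-1} = e_{r-2} + e_{r-1}
simpleRoot : (t : RootType) → Fin (rankT t) → Fin (ambT t) → ℤ
simpleRoot (A r) k j = δ (toℕ j) (toℕ k) ℤ.- δ (toℕ j) (suc (toℕ k))
simpleRoot (B r) k j =
  if ⌊ suc (toℕ k) ℕ.<? r ⌋ then δ (toℕ j) (toℕ k) ℤ.- δ (toℕ j) (suc (toℕ k))
  else δ (toℕ j) (toℕ k)
simpleRoot (C r) k j =
  if ⌊ suc (toℕ k) ℕ.<? r ⌋ then δ (toℕ j) (toℕ k) ℤ.- δ (toℕ j) (suc (toℕ k))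
  else + 2 ℤ.* δ (toℕ j) (toℕ k)
simpleRoot (D r) k j =
  if ⌊ suc (toℕ k) ℕ.<? r ⌋ then δ (toℕ j) (toℕ k) ℤ.- δ (toℕ j) (suc (toℕ k))
  else δ (toℕ j) (toℕ k) ℤ.+ δ (toℕ j) (ℕ.pred (toℕ k))

combine : (t : RootType) → (Fin (rankT t) → ℤ) → Fin (ambT t) → ℤ
combine t c j = sumℤ (λ k → c k ℤ.* simpleRoot t k j)

Sgn : ℤ → Set
Sgn s = s ≡ + 1 ⊎ s ≡ -[1+ 0 ]

TwoIndex : ∀ {m} → (Fin m → ℤ) → Set
TwoIndex {m} β = Σ (Fin m) λ i → Σ (Fin m) λ j → i ≢ j × Σ ℤ λ s → Σ ℤ λ s' →
  Sgn s × Sgn s' × (∀ x → β x ≡ s ℤ.* e i x ℤ.+ s' ℤ.* e j x)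

OneIndex : ∀ {m} → ℤ → (Fin m → ℤ) → Set
OneIndex {m} a β = Σ (Fin m) λ i → Σ ℤ λ s → Sgn s × (∀ x → β x ≡ s ℤ.* (a ℤ.* e i x))

AmbientRoot : (t : RootType) → (Fin (ambT t) → ℤ) → Set
AmbientRoot (A r) β = Σ (Fin (suc r)) λ i → Σ (Fin (suc r)) λ j → i ≢ j ×
  (∀ x → β x ≡ e i x ℤ.- e j x)
AmbientRoot (B r) β = OneIndex (+ 1) β ⊎ TwoIndex β
AmbientRoot (C r) β = OneIndex (+ 2) β ⊎ TwoIndex β
AmbientRoot (D r) β = TwoIndex β

-- roots of the irreducible system of type t, in coordinates w.r.t. the simple roots
-- (a ℤ-basis of the root lattice N ≅ ℤ^{rank})
IsRootIrr : (t : RootType) → (Fin (rankT t) → ℤ) → Set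
IsRootIrr t c = AmbientRoot t (combine t c)

rank : List RootType → ℕ
rank []       = 0
rank (t ∷ ts) = rankT t ℕ.+ rank ts

IsRoot : (ts : List RootType) → (Fin (rank ts) → ℤ) → Set
IsRoot []       c = ⊥
IsRoot (t ∷ ts) c =
    (IsRootIrr t (λ j → c (j ↑ˡ rank ts)) × (∀ j → c (rankT t ↑ʳ j) ≡ + 0))
  ⊎ ((∀ j → c (j ↑ˡ rank ts) ≡ + 0) × IsRoot ts (λ j → c (rankT t ↑ʳ j)))

AllValid : List RootType → Set
AllValid []       = ⊤
AllValid (t ∷ ts) = ValidType t × AllValid ts

-- Lattice polytopes P = conv(S), S a finite list of points of M = ℤ^n

-- affine independence of points p_0, ..., p_k (tested with integer
-- coefficients, equivalent to rational ones after clearing denominators)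
AffInd : ∀ {n m} → (Fin m → Fin n → ℤ) → Set
AffInd {n} {zero}  p = ⊤
AffInd {n} {suc k} p = (c : Fin k → ℤ) →
  (∀ j → sumℤ (λ i → c i ℤ.* (p (fsuc i) j ℤ.- p fzero j)) ≡ + 0) → ∀ i → c i ≡ + 0

FullDim : ∀ {n} → List (Fin n → ℤ) → Set
FullDim {n} S = Σ (Fin (suc n) → Fin n → ℤ) λ p → (∀ i → p i ∈ S) × AffInd p

Primitive : ∀ {n} → (Fin n → ℤ) → Set
Primitive v = ∀ (d : ℕ) → (∀ j → (+ d) ∣ℤ v j) → d ≡ 1

-- v is the primitive inward normal of a facet of conv(S):
-- ⟨x , v⟩ ≥ a on P, and the face {⟨x , v⟩ = a} has dimension n - 1
IsFacetNormal : ∀ {n} → List (Fin n → ℤ) → (Fin n → ℤ) → Set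
IsFacetNormal {n} S v = Primitive v × Σ ℤ λ a →
  (∀ s → s ∈ S → a ℤ.≤ ⟪ s , v ⟫) ×
  Σ (Fin n → Fin n → ℤ) λ p → (∀ i → p i ∈ S × ⟪ p i , v ⟫ ≡ a) × AffInd p

SpannedByRoot : (ts : List RootType) → (Fin (rank ts) → ℤ) → Set
SpannedByRoot ts v = Σ (Fin (rank ts) → ℤ) λ α → IsRoot ts α ×
  Σ ℚ λ t → ∀ j → ι (v j) ≡ t ℚ.* ι (α j)

CutOutBy : (ts : List RootType) → List (Fin (rank ts) → ℤ) → Set
CutOutBy ts S = ∀ v → IsFacetNormal S v → SpannedByRoot ts v

-- u lies in the interior of the diagonal splitting polytope F_P
InInteriorF : ∀ {n} → List (Fin n → ℤ) → (Fin n → ℚ) → Set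
InInteriorF S u = ∀ v → IsFacetNormal S v →
  (ℚ.- ℚ.1ℚ) ℚ.< ⟪ u , v ⟫ℚ × ⟪ u , v ⟫ℚ ℚ.< ℚ.1ℚ

-- P is diagonally split for q: every class of (1/q)M / M, i.e. every w/q with
-- w ∈ M, has a representative w/q + z (z ∈ M) in the interior of F_P
DiagonallySplit : ∀ {n} → List (Fin n → ℤ) → (q : ℕ) → .{{NonZero q}} → Set
DiagonallySplit {n} S q = (w : Fin n → ℤ) → Σ (Fin n → ℤ) λ z →
  InInteriorF S (λ j → (w j ℚ./ q) ℚ.+ ι (z j))

Odd : ℕ → Set
Odd q = Σ ℕ λ k → q ≡ suc (2 ℕ.* k)

module Submission where

open import Defs
open import Data.Nat using (ℕ; _≤_; NonZero)
open import Data.Integer using (ℤ)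
open import Data.Fin using (Fin)
open import Data.List using (List; []; _∷_)

open import Data.Nat as ℕ using (zero; suc; s≤s)
import Data.Nat.Properties as ℕP
import Data.Nat.Divisibility as ℕDiv
open import Data.Integer as ℤ using (+_; -[1+_]; _+_; _*_; -_; _-_; ∣_∣)
import Data.Integer.Properties as ℤP
import Data.Integer.DivMod as ℤDivMod
open import Data.Integer.Tactic.RingSolver using (solve-∀)
open import Data.Rational as ℚ using (ℚ)
import Data.Rational.Properties as ℚP
open import Data.Rational.Solver using (module +-*-Solver)
open import Data.Rational.Unnormalised as ℚᵘ using (mkℚᵘ; *≡*; *<*)
import Data.Rational.Unnormalised.Properties as ℚᵘP
open import Data.Fin as Fin using (toℕ; fromℕ<; _↑ˡ_; _↑ʳ_) renaming (zero to fzero; suc to fsuc)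
import Data.Fin.Properties as FinP
open import Data.Bool using (if_then_else_)
open import Data.Product using (Σ; _×_; _,_; proj₁; proj₂)
open import Data.Sum using (inj₁; inj₂; [_,_]′)
open import Function using (_∘_; flip)
open import Relation.Nullary using (yes; no; ¬_; Dec; contradiction)
open import Relation.Nullary.Decidable using (⌊_⌋)
open import Relation.Binary.PropositionalEquality
open import Algebra.Properties.Semiring.Sum ℤP.+-*-semiring
  using (∑-distrib-+; ∑-comm; *-distribˡ-sum; sum-replicate-zero) renaming (sum to ∑)

-- Every facet normal v is a rational multiple of a root α; roots have
-- integral duals g (⟨g, α⟩ = 1), so the primitive v is ±α and
-- ⟨u, v⟩ = ±⟨w + qz, α⟩ / q.  Hence it suffices to find a small
-- representative: z with |⟨w + qz, α⟩| < q for all roots α.  For irreducible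
-- Φ_i we use the standard ambient lattice, whose roots are ±e_i ± e_j, ±e_i,
-- ±2e_i: partial sums give X with ⟨X, α_k⟩ = 2(m+1) w_k ≡ w_k (mod q) on the
-- simple roots, and reducing X symmetrically mod q gives y with |y_j| ≤ m,
-- so |⟨y, β⟩| ≤ 2m < q on ambient roots.  Direct sums are handled blockwise.

sumℤ≡∑ : ∀ {n} (f : Fin n → ℤ) → sumℤ f ≡ ∑ f
sumℤ≡∑ {zero}  f = refl
sumℤ≡∑ {suc n} f = cong (λ s → f fzero + s) (sumℤ≡∑ (f ∘ fsuc))

sum-cong : ∀ {n} {f g : Fin n → ℤ} → (∀ j → f j ≡ g j) → sumℤ f ≡ sumℤ g
sum-cong {zero}  f≗g = refl
sum-cong {suc n} f≗g = cong₂ _+_ (f≗g fzero) (sum-cong (f≗g ∘ fsuc))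

sum-zero : ∀ n → sumℤ {n} (λ _ → + 0) ≡ + 0
sum-zero n = trans (sumℤ≡∑ {n} (λ _ → + 0)) (sum-replicate-zero n)

sum-+ : ∀ {n} (f g : Fin n → ℤ) → sumℤ (λ j → f j + g j) ≡ sumℤ f + sumℤ g
sum-+ f g = trans (sumℤ≡∑ (λ j → f j + g j))
  (trans (∑-distrib-+ f g) (sym (cong₂ _+_ (sumℤ≡∑ f) (sumℤ≡∑ g))))

sum-*ˡ : ∀ {n} (a : ℤ) (f : Fin n → ℤ) → sumℤ (λ j → a * f j) ≡ a * sumℤ f
sum-*ˡ a f = trans (sumℤ≡∑ (λ j → a * f j))
  (trans (sym (*-distribˡ-sum a f)) (cong (a *_) (sym (sumℤ≡∑ f))))

sum-comm : ∀ {m n} (f : Fin m → Fin n → ℤ) →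
  sumℤ (λ i → sumℤ (f i)) ≡ sumℤ (λ j → sumℤ (λ i → f i j))
sum-comm f = trans (double f) (trans (∑-comm f) (sym (double (flip f))))
  where
  double : ∀ {m n} (g : Fin m → Fin n → ℤ) → sumℤ (λ i → sumℤ (g i)) ≡ ∑ (λ i → ∑ (g i))
  double g = trans (sum-cong (λ i → sumℤ≡∑ (g i))) (sumℤ≡∑ (λ i → ∑ (g i)))

sum-split : ∀ m {n} (f : Fin (m ℕ.+ n) → ℤ) →
  sumℤ f ≡ sumℤ (f ∘ (_↑ˡ n)) + sumℤ (f ∘ (m ↑ʳ_))
sum-split zero    f = sym (ℤP.+-identityˡ _)
sum-split (suc m) f =
  trans (cong (λ s → f fzero + s) (sum-split m (f ∘ fsuc))) (sym (ℤP.+-assoc (f fzero) _ _))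

pair-congˡ : ∀ {n} {x x' : Fin n → ℤ} (v : Fin n → ℤ) →
  (∀ j → x j ≡ x' j) → ⟪ x , v ⟫ ≡ ⟪ x' , v ⟫
pair-congˡ v x≗x' = sum-cong (λ j → cong (_* v j) (x≗x' j))

pair-congʳ : ∀ {n} (x : Fin n → ℤ) {v v' : Fin n → ℤ} →
  (∀ j → v j ≡ v' j) → ⟪ x , v ⟫ ≡ ⟪ x , v' ⟫
pair-congʳ x v≗v' = sum-cong (λ j → cong (x j *_) (v≗v' j))

pair-+ˡ : ∀ {n} (x y v : Fin n → ℤ) → ⟪ (λ j → x j + y j) , v ⟫ ≡ ⟪ x , v ⟫ + ⟪ y , v ⟫
pair-+ˡ x y v = trans (sum-cong (λ j → ℤP.*-distribʳ-+ (v j) (x j) (y j)))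
  (sum-+ (λ j → x j * v j) (λ j → y j * v j))

pair-*ˡ : ∀ {n} (a : ℤ) (x v : Fin n → ℤ) → ⟪ (λ j → a * x j) , v ⟫ ≡ a * ⟪ x , v ⟫
pair-*ˡ a x v = trans (sum-cong (λ j → ℤP.*-assoc a (x j) (v j))) (sum-*ˡ a (λ j → x j * v j))

pair-+ʳ : ∀ {n} (x u v : Fin n → ℤ) → ⟪ x , (λ j → u j + v j) ⟫ ≡ ⟪ x , u ⟫ + ⟪ x , v ⟫
pair-+ʳ x u v = trans (sum-cong (λ j → ℤP.*-distribˡ-+ (x j) (u j) (v j)))
  (sum-+ (λ j → x j * u j) (λ j → x j * v j))

pair-*ʳ : ∀ {n} (a : ℤ) (x v : Fin n → ℤ) → ⟪ x , (λ j → a * v j) ⟫ ≡ a * ⟪ x , v ⟫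
pair-*ʳ a x v = trans (sum-cong (λ j → swap (x j) a (v j))) (sum-*ˡ a (λ j → x j * v j))
  where
  swap : ∀ b a c → b * (a * c) ≡ a * (b * c)
  swap = solve-∀

pair--ʳ : ∀ {n} (x u v : Fin n → ℤ) → ⟪ x , (λ j → u j - v j) ⟫ ≡ ⟪ x , u ⟫ - ⟪ x , v ⟫
pair--ʳ x u v = begin
  ⟪ x , (λ j → u j - v j) ⟫
    ≡⟨ pair-congʳ x (λ j → cong (λ s → u j + s) (sym (ℤP.-1*i≡-i (v j)))) ⟩
  ⟪ x , (λ j → u j + ℤ.-1ℤ * v j) ⟫
    ≡⟨ pair-+ʳ x u _ ⟩
  ⟪ x , u ⟫ + ⟪ x , (λ j → ℤ.-1ℤ * v j) ⟫
    ≡⟨ cong (λ s → ⟪ x , u ⟫ + s) (trans (pair-*ʳ ℤ.-1ℤ x v) (ℤP.-1*i≡-i _)) ⟩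
  ⟪ x , u ⟫ - ⟪ x , v ⟫
    ∎
  where open ≡-Reasoning

pair-zeroʳ : ∀ {n} (x v : Fin n → ℤ) → (∀ j → v j ≡ + 0) → ⟪ x , v ⟫ ≡ + 0
pair-zeroʳ {n} x v v≗0 =
  trans (sum-cong (λ j → trans (cong (x j *_) (v≗0 j)) (ℤP.*-zeroʳ (x j)))) (sum-zero n)

if-yes : ∀ {P A : Set} {a b : A} (d : Dec P) → P → (if ⌊ d ⌋ then a else b) ≡ a
if-yes (yes _) _ = refl
if-yes (no ¬p) p = contradiction p ¬p

if-no : ∀ {P A : Set} {a b : A} (d : Dec P) → ¬ P → (if ⌊ d ⌋ then a else b) ≡ b
if-no (yes p) ¬p = contradiction p ¬p
if-no (no _)  _  = refl

if-elim : ∀ {P A : Set} {a b c : A} (d : Dec P) → (P → a ≡ c) → (¬ P → b ≡ c) →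
  (if ⌊ d ⌋ then a else b) ≡ c
if-elim (yes p) a≡c _   = a≡c p
if-elim (no ¬p) _   b≡c = b≡c ¬p

e-diag : ∀ {m} (i : Fin m) → e i i ≡ + 1
e-diag i = if-yes (i FinP.≟ i) refl

e-off : ∀ {m} (i j : Fin m) → i ≢ j → e i j ≡ + 0
e-off i j = if-no (i FinP.≟ j)

δ-toℕ : ∀ {m} (i j : Fin m) → δ (toℕ j) (toℕ i) ≡ e i j
δ-toℕ i j with i FinP.≟ j
... | yes refl = if-yes (toℕ i ℕ.≟ toℕ i) refl
... | no i≢j   = if-no (toℕ j ℕ.≟ toℕ i) (λ eq → i≢j (FinP.toℕ-injective (sym eq)))

pair-basis : ∀ {m} (y : Fin m → ℤ) (i : Fin m) → ⟪ y , e i ⟫ ≡ y i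
pair-basis {suc m} y fzero = begin
  y fzero * + 1 + sumℤ (λ j → y (fsuc j) * + 0)
    ≡⟨ cong₂ _+_ (ℤP.*-identityʳ (y fzero)) (pair-zeroʳ (y ∘ fsuc) _ (λ _ → refl)) ⟩
  y fzero + + 0
    ≡⟨ ℤP.+-identityʳ (y fzero) ⟩
  y fzero
    ∎
  where open ≡-Reasoning
pair-basis {suc m} y (fsuc i) = begin
  y fzero * + 0 + ⟪ y ∘ fsuc , e (fsuc i) ∘ fsuc ⟫
    ≡⟨ cong₂ _+_ (ℤP.*-zeroʳ (y fzero)) (pair-congʳ (y ∘ fsuc) e-suc) ⟩
  + 0 + ⟪ y ∘ fsuc , e i ⟫
    ≡⟨ ℤP.+-identityˡ _ ⟩
  ⟪ y ∘ fsuc , e i ⟫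
    ≡⟨ pair-basis (y ∘ fsuc) i ⟩
  y (fsuc i)
    ∎
  where
  open ≡-Reasoning
  e-suc : ∀ x → e (fsuc i) (fsuc x) ≡ e i x
  e-suc x = by-cases (i FinP.≟ x)
    where
    by-cases : Dec (i ≡ x) → e (fsuc i) (fsuc x) ≡ e i x
    by-cases (yes refl) = trans (e-diag (fsuc i)) (sym (e-diag i))
    by-cases (no i≢x)   =
      trans (e-off (fsuc i) (fsuc x) (i≢x ∘ FinP.suc-injective)) (sym (e-off i x i≢x))

restrict : ∀ {m} → (ℕ → ℤ) → Fin m → ℤ
restrict Y j = Y (toℕ j)

δ̂ : ∀ {m} → ℕ → Fin m → ℤ
δ̂ a j = δ (toℕ j) a

diff : ∀ {m n} → Fin n → Fin m → ℤ
diff k j = δ̂ (toℕ k) j - δ̂ (suc (toℕ k)) j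

pair-δ : ∀ {m} (Y : ℕ → ℤ) a → a ℕ.< m → ⟪ restrict {m} Y , δ̂ a ⟫ ≡ Y a
pair-δ {m} Y a a<m = begin
  ⟪ restrict {m} Y , δ̂ a ⟫             ≡⟨ pair-congʳ (restrict Y) δ≗e ⟩
  ⟪ restrict Y , e i ⟫                 ≡⟨ pair-basis (restrict Y) i ⟩
  Y (toℕ i)                            ≡⟨ cong Y (FinP.toℕ-fromℕ< a<m) ⟩
  Y a                                  ∎
  where
  open ≡-Reasoning
  i : Fin m
  i = fromℕ< a<m
  δ≗e : ∀ j → δ (toℕ j) a ≡ e i j
  δ≗e j = subst (λ b → δ (toℕ j) b ≡ e i j) (FinP.toℕ-fromℕ< a<m) (δ-toℕ i j)

pair-δ-diff : ∀ {m} (Y : ℕ → ℤ) a b → a ℕ.< m → b ℕ.< m →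
  ⟪ restrict {m} Y , (λ j → δ̂ a j - δ̂ b j) ⟫ ≡ Y a - Y b
pair-δ-diff {m} Y a b a<m b<m =
  trans (pair--ʳ (restrict {m} Y) (δ̂ a) (δ̂ b)) (cong₂ _-_ (pair-δ Y a a<m) (pair-δ Y b b<m))

simplePairing : (t : RootType) → (ℕ → ℤ) → Fin (rankT t) → ℤ
simplePairing (A r) Y k = Y (toℕ k) - Y (suc (toℕ k))
simplePairing (B r) Y k =
  if ⌊ suc (toℕ k) ℕ.<? r ⌋ then Y (toℕ k) - Y (suc (toℕ k)) else Y (toℕ k)
simplePairing (C r) Y k =
  if ⌊ suc (toℕ k) ℕ.<? r ⌋ then Y (toℕ k) - Y (suc (toℕ k)) else + 2 * Y (toℕ k)
simplePairing (D r) Y k =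
  if ⌊ suc (toℕ k) ℕ.<? r ⌋ then Y (toℕ k) - Y (suc (toℕ k)) else Y (toℕ k) + Y (ℕ.pred (toℕ k))

pair-if : ∀ {n} {P : Set} (x : Fin n → ℤ) (d : Dec P) (f g : Fin n → ℤ) {a b : ℤ} →
  (P → ⟪ x , f ⟫ ≡ a) → (¬ P → ⟪ x , g ⟫ ≡ b) →
  ⟪ x , (λ j → if ⌊ d ⌋ then f j else g j) ⟫ ≡ (if ⌊ d ⌋ then a else b)
pair-if x (yes p) f g x·f _   = x·f p
pair-if x (no ¬p) f g _   x·g = x·g ¬p

pair-simpleRoot : ∀ t (Y : ℕ → ℤ) k → ⟪ restrict Y , simpleRoot t k ⟫ ≡ simplePairing t Y k
pair-simpleRoot (A r) Y k =
  pair-δ-diff {suc r} Y (toℕ k) (suc (toℕ k)) (ℕP.m<n⇒m<1+n (FinP.toℕ<n k)) (s≤s (FinP.toℕ<n k))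
pair-simpleRoot (B r) Y k = pair-if (restrict {r} Y) (suc (toℕ k) ℕ.<? r) (diff k) (δ̂ (toℕ k))
  (pair-δ-diff {r} Y (toℕ k) (suc (toℕ k)) (FinP.toℕ<n k))
  (λ _ → pair-δ {r} Y (toℕ k) (FinP.toℕ<n k))
pair-simpleRoot (C r) Y k =
  pair-if (restrict {r} Y) (suc (toℕ k) ℕ.<? r) (diff k) (λ j → + 2 * δ̂ (toℕ k) j)
  (pair-δ-diff {r} Y (toℕ k) (suc (toℕ k)) (FinP.toℕ<n k))
  (λ _ → trans (pair-*ʳ (+ 2) (restrict {r} Y) (δ̂ (toℕ k)))
                (cong (+ 2 *_) (pair-δ {r} Y (toℕ k) (FinP.toℕ<n k))))
pair-simpleRoot (D r) Y k =
  pair-if (restrict {r} Y) (suc (toℕ k) ℕ.<? r) (diff k) (λ j → δ̂ (toℕ k) j + δ̂ (ℕ.pred (toℕ k)) j)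
  (pair-δ-diff {r} Y (toℕ k) (suc (toℕ k)) (FinP.toℕ<n k))
  (λ _ → trans (pair-+ʳ (restrict {r} Y) (δ̂ (toℕ k)) (δ̂ (ℕ.pred (toℕ k))))
    (cong₂ _+_ (pair-δ {r} Y (toℕ k) (FinP.toℕ<n k))
               (pair-δ {r} Y (ℕ.pred (toℕ k)) (ℕP.≤-<-trans ℕP.pred[n]≤n (FinP.toℕ<n k)))))

pair-combine : ∀ t (y : Fin (ambT t) → ℤ) (c : Fin (rankT t) → ℤ) →
  ⟪ y , combine t c ⟫ ≡ ⟪ (λ k → ⟪ y , simpleRoot t k ⟫) , c ⟫
pair-combine t y c = begin
  sumℤ (λ j → y j * sumℤ (λ k → c k * α k j))
    ≡⟨ sum-cong (λ j → sym (sum-*ˡ (y j) (λ k → c k * α k j))) ⟩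
  sumℤ (λ j → sumℤ (λ k → y j * (c k * α k j)))
    ≡⟨ sum-comm (λ j k → y j * (c k * α k j)) ⟩
  sumℤ (λ k → sumℤ (λ j → y j * (c k * α k j)))
    ≡⟨ sum-cong (λ k → trans (pair-*ʳ (c k) y (α k)) (ℤP.*-comm (c k) _)) ⟩
  sumℤ (λ k → ⟪ y , α k ⟫ * c k) ∎
  where
  open ≡-Reasoning
  α : Fin (rankT t) → Fin (ambT t) → ℤ
  α = simpleRoot t

-- Partial sums from the right: for k ≤ L,
--   chain V T L k = V k + V (k+1) + … + V (L-1) + T L,
-- and chain V T L k = T k for k ≥ L.  Consecutive differences recover V.
chainFrom : (ℕ → ℤ) → (ℕ → ℤ) → ℕ → ℕ → ℤ
chainFrom V T k zero    = T k
chainFrom V T k (suc l) = V k + chainFrom V T (suc k) l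

chain : (ℕ → ℤ) → (ℕ → ℤ) → ℕ → ℕ → ℤ
chain V T L k = chainFrom V T k (L ℕ.∸ k)

chain-end : ∀ V T L k → L ℕ.≤ k → chain V T L k ≡ T k
chain-end V T L k L≤k = cong (chainFrom V T k) (ℕP.m≤n⇒m∸n≡0 L≤k)

chain-diff : ∀ V T L k → k ℕ.< L → chain V T L k - chain V T L (suc k) ≡ V k
chain-diff V T L k k<L = begin
  chain V T L k - chain V T L (suc k)            ≡⟨ cong (_- chain V T L (suc k)) step ⟩
  V k + chain V T L (suc k) - chain V T L (suc k) ≡⟨ cancel (V k) (chain V T L (suc k)) ⟩
  V k                                            ∎
  where
  open ≡-Reasoning
  step : chain V T L k ≡ V k + chain V T L (suc k)
  step = cong (chainFrom V T k) (ℕP.+-∸-assoc 1 k<L)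
  cancel : ∀ a b → a + b - b ≡ a
  cancel = solve-∀

-- Type D_{r+2}: the chain ends in H r + H (r+1) and H (r+1) - H r, which
-- pair correctly with the fork α_r = e_r - e_{r+1}, α_{r+1} = e_r + e_{r+1}.
prescribe-D : ∀ r (H : ℕ → ℤ) →
  Σ (ℕ → ℤ) λ X → ∀ k → simplePairing (D (suc (suc r))) X k ≡ + 2 * H (toℕ k)
prescribe-D r H = X , λ k → if-elim (suc (toℕ k) ℕ.<? suc (suc r))
  (λ k+1<r+2 → [ chain-diff V T r (toℕ k)
               , (λ k≡r → subst (λ n → X n - X (suc n) ≡ V n) (sym k≡r) fork) ]′
               (ℕP.m≤n⇒m<n∨m≡n (ℕP.≤-pred (ℕP.≤-pred k+1<r+2))))
  (λ k+1≮r+2 → subst (λ n → X n + X (ℕ.pred n) ≡ V n) (sym (k≡r+1 k k+1≮r+2)) last)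
  where
  V : ℕ → ℤ
  V n = + 2 * H n
  T : ℕ → ℤ
  T n = if ⌊ n ℕ.≟ r ⌋ then H n + H (suc n) else H n - H (ℕ.pred n)
  X : ℕ → ℤ
  X = chain V T r
  X-r : X r ≡ H r + H (suc r)
  X-r = trans (chain-end V T r r ℕP.≤-refl) (if-yes (r ℕ.≟ r) refl)
  X-r+1 : X (suc r) ≡ H (suc r) - H r
  X-r+1 = trans (chain-end V T r (suc r) (ℕP.n≤1+n r)) (if-no (suc r ℕ.≟ r) ℕP.1+n≢n)
  fork : X r - X (suc r) ≡ V r
  fork = trans (cong₂ _-_ X-r X-r+1) (difference (H r) (H (suc r)))
    where
    difference : ∀ a b → a + b - (b - a) ≡ + 2 * a
    difference = solve-∀
  last : X (suc r) + X r ≡ V (suc r)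
  last = trans (cong₂ _+_ X-r+1 X-r) (add (H r) (H (suc r)))
    where
    add : ∀ a b → b - a + (a + b) ≡ + 2 * b
    add = solve-∀
  k≡r+1 : ∀ (k : Fin (suc (suc r))) → ¬ suc (toℕ k) ℕ.< suc (suc r) → toℕ k ≡ suc r
  k≡r+1 k k+1≮r+2 = ℕP.≤-antisym (ℕP.≤-pred (FinP.toℕ<n k)) (ℕP.≤-pred (ℕP.≮⇒≥ k+1≮r+2))

-- The pairings of ambient vectors with the simple roots can be prescribed up
-- to a factor 2: for every H there is X with ⟨X, α_k⟩ = 2 H_k.  (The factor is
-- needed for the last simple roots 2e_{r-1} of C_r and e_{r-2} + e_{r-1} of D_r.)
prescribe : ∀ t → ValidType t → (H : ℕ → ℤ) →
  Σ (ℕ → ℤ) λ X → ∀ k → simplePairing t X k ≡ + 2 * H (toℕ k)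
prescribe (A r) _ H = X , λ k → chain-diff V (λ _ → + 0) r (toℕ k) (FinP.toℕ<n k)
  where
  V : ℕ → ℤ
  V n = + 2 * H n
  X : ℕ → ℤ
  X = chain V (λ _ → + 0) r
prescribe (B r) _ H = X , λ k → if-elim (suc (toℕ k) ℕ.<? r)
  (λ k+1<r → chain-diff V V (ℕ.pred r) (toℕ k) (ℕP.pred-mono-≤ k+1<r))
  (λ k+1≮r → chain-end V V (ℕ.pred r) (toℕ k) (ℕP.pred-mono-≤ (ℕP.≮⇒≥ k+1≮r)))
  where
  V : ℕ → ℤ
  V n = + 2 * H n
  X : ℕ → ℤ
  X = chain V V (ℕ.pred r)
prescribe (C r) _ H = X , λ k → if-elim (suc (toℕ k) ℕ.<? r)
  (λ k+1<r → chain-diff V H (ℕ.pred r) (toℕ k) (ℕP.pred-mono-≤ k+1<r))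
  (λ k+1≮r → cong (+ 2 *_) (chain-end V H (ℕ.pred r) (toℕ k) (ℕP.pred-mono-≤ (ℕP.≮⇒≥ k+1≮r))))
  where
  V : ℕ → ℤ
  V n = + 2 * H n
  X : ℕ → ℤ
  X = chain V H (ℕ.pred r)
prescribe (D zero)          ()        H
prescribe (D (suc zero))    (s≤s ())  H
prescribe (D (suc (suc r))) _ H = prescribe-D r H

symmetric-residue : ∀ m (a : ℤ) →
  Σ ℤ λ y → Σ ℤ λ d → (a ≡ y + + suc (2 ℕ.* m) * d) × ∣ y ∣ ℕ.≤ m
symmetric-residue m a = choose (r ℕ.≤? m)
  where
  q : ℕ
  q = suc (2 ℕ.* m)
  r : ℕ
  r = a ℤDivMod.%ℕ q
  d : ℤ
  d = a ℤDivMod./ℕ q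
  a≡r+dq : a ≡ + r + d * + q
  a≡r+dq = ℤDivMod.a≡a%ℕn+[a/ℕn]*n a q
  choose : Dec (r ℕ.≤ m) → Σ ℤ λ y → Σ ℤ λ d → (a ≡ y + + q * d) × ∣ y ∣ ℕ.≤ m
  choose (yes r≤m) = + r , d , trans a≡r+dq (cong (λ x → + r + x) (ℤP.*-comm d (+ q))) , r≤m
  choose (no r≰m)  = - + s , d + + 1 , a≡-s+q[d+1] , subst (ℕ._≤ m) (sym (ℤP.∣-i∣≡∣i∣ (+ s))) s≤m
    where
    -- the residue r > m is replaced by r - q = -s with s = q - r < q - m
    s : ℕ
    s = q ℕ.∸ r
    s≤m : s ℕ.≤ m
    s≤m = ℕP.≤-trans (ℕP.∸-monoʳ-≤ q (ℕP.≰⇒> r≰m))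
                     (ℕP.≤-reflexive (trans (ℕP.m+n∸m≡n m (m ℕ.+ 0)) (ℕP.+-identityʳ m)))
    r+s≡q : + r + + s ≡ + q
    r+s≡q = cong +_ (ℕP.m+[n∸m]≡n (ℕP.<⇒≤ (ℤDivMod.n%ℕd<d a q)))
    regroup : ∀ r s q d → r + s ≡ q → r + d * q ≡ - s + q * (d + + 1)
    regroup r s q d r+s≡q = begin
      r + d * q                    ≡⟨ cong (λ x → r + d * x) (sym r+s≡q) ⟩
      r + d * (r + s)              ≡⟨ expand r s d ⟩
      - s + (r + s) * (d + + 1)    ≡⟨ cong (λ x → - s + x * (d + + 1)) r+s≡q ⟩
      - s + q * (d + + 1)          ∎
      where
      open ≡-Reasoning
      expand : ∀ r s d → r + d * (r + s) ≡ - s + (r + s) * (d + + 1)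
      expand = solve-∀
    a≡-s+q[d+1] : a ≡ - + s + + q * (d + + 1)
    a≡-s+q[d+1] = trans a≡r+dq (regroup (+ r) (+ s) (+ q) d r+s≡q)

abs-sign : ∀ {s} → Sgn s → (x : ℤ) → ∣ s * x ∣ ≡ ∣ x ∣
abs-sign (inj₁ refl) x = cong ∣_∣ (ℤP.*-identityˡ x)
abs-sign (inj₂ refl) x = trans (cong ∣_∣ (ℤP.-1*i≡-i x)) (ℤP.∣-i∣≡∣i∣ x)

pair-typeA : ∀ {n} (y β : Fin n → ℤ) (i j : Fin n) →
  (∀ x → β x ≡ e i x - e j x) → ⟪ y , β ⟫ ≡ y i - y j
pair-typeA y β i j β≡ =
  trans (pair-congʳ y β≡) (trans (pair--ʳ y (e i) (e j)) (cong₂ _-_ (pair-basis y i) (pair-basis y j)))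

pair-twoIndex : ∀ {n} (y β : Fin n → ℤ) (i j : Fin n) (s s' : ℤ) →
  (∀ x → β x ≡ s * e i x + s' * e j x) → ⟪ y , β ⟫ ≡ s * y i + s' * y j
pair-twoIndex y β i j s s' β≡ = begin
  ⟪ y , β ⟫
    ≡⟨ pair-congʳ y β≡ ⟩
  ⟪ y , (λ x → s * e i x + s' * e j x) ⟫
    ≡⟨ pair-+ʳ y _ _ ⟩
  ⟪ y , (λ x → s * e i x) ⟫ + ⟪ y , (λ x → s' * e j x) ⟫
    ≡⟨ cong₂ _+_ (pair-*ʳ s y (e i)) (pair-*ʳ s' y (e j)) ⟩
  s * ⟪ y , e i ⟫ + s' * ⟪ y , e j ⟫
    ≡⟨ cong₂ (λ a b → s * a + s' * b) (pair-basis y i) (pair-basis y j) ⟩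
  s * y i + s' * y j
    ∎
  where open ≡-Reasoning

pair-oneIndex : ∀ {n} (y β : Fin n → ℤ) (i : Fin n) (s a : ℤ) →
  (∀ x → β x ≡ s * (a * e i x)) → ⟪ y , β ⟫ ≡ s * (a * y i)
pair-oneIndex y β i s a β≡ = begin
  ⟪ y , β ⟫                           ≡⟨ pair-congʳ y β≡ ⟩
  ⟪ y , (λ x → s * (a * e i x)) ⟫     ≡⟨ pair-*ʳ s y _ ⟩
  s * ⟪ y , (λ x → a * e i x) ⟫       ≡⟨ cong (s *_) (pair-*ʳ a y (e i)) ⟩
  s * (a * ⟪ y , e i ⟫)               ≡⟨ cong (λ b → s * (a * b)) (pair-basis y i) ⟩
  s * (a * y i)                       ∎
  where open ≡-Reasoning

typeA-bound : ∀ {n} m (y β : Fin n → ℤ) → (∀ j → ∣ y j ∣ ℕ.≤ m) →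
  (Σ (Fin n) λ i → Σ (Fin n) λ j → i ≢ j × (∀ x → β x ≡ e i x - e j x)) →
  ∣ ⟪ y , β ⟫ ∣ ℕ.≤ m ℕ.+ m
typeA-bound m y β small (i , j , _ , β≡) = begin
  ∣ ⟪ y , β ⟫ ∣          ≡⟨ cong ∣_∣ (pair-typeA y β i j β≡) ⟩
  ∣ y i - y j ∣          ≤⟨ ℤP.∣i-j∣≤∣i∣+∣j∣ (y i) (y j) ⟩
  ∣ y i ∣ ℕ.+ ∣ y j ∣    ≤⟨ ℕP.+-mono-≤ (small i) (small j) ⟩
  m ℕ.+ m                ∎
  where open ℕP.≤-Reasoning

twoIndex-bound : ∀ {n} m (y β : Fin n → ℤ) → (∀ j → ∣ y j ∣ ℕ.≤ m) → TwoIndex β →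
  ∣ ⟪ y , β ⟫ ∣ ℕ.≤ m ℕ.+ m
twoIndex-bound m y β small (i , j , _ , s , s' , sgn , sgn' , β≡) = begin
  ∣ ⟪ y , β ⟫ ∣                   ≡⟨ cong ∣_∣ (pair-twoIndex y β i j s s' β≡) ⟩
  ∣ s * y i + s' * y j ∣          ≤⟨ ℤP.∣i+j∣≤∣i∣+∣j∣ (s * y i) (s' * y j) ⟩
  ∣ s * y i ∣ ℕ.+ ∣ s' * y j ∣    ≡⟨ cong₂ ℕ._+_ (abs-sign sgn (y i)) (abs-sign sgn' (y j)) ⟩
  ∣ y i ∣ ℕ.+ ∣ y j ∣             ≤⟨ ℕP.+-mono-≤ (small i) (small j) ⟩
  m ℕ.+ m                         ∎
  where open ℕP.≤-Reasoning

oneIndex-bound : ∀ {n} m (a : ℤ) (y β : Fin n → ℤ) → (∀ j → ∣ y j ∣ ℕ.≤ m) → OneIndex a β →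
  ∣ ⟪ y , β ⟫ ∣ ℕ.≤ ∣ a ∣ ℕ.* m
oneIndex-bound m a y β small (i , s , sgn , β≡) = begin
  ∣ ⟪ y , β ⟫ ∣          ≡⟨ cong ∣_∣ (pair-oneIndex y β i s a β≡) ⟩
  ∣ s * (a * y i) ∣      ≡⟨ abs-sign sgn (a * y i) ⟩
  ∣ a * y i ∣            ≡⟨ ℤP.abs-* a (y i) ⟩
  ∣ a ∣ ℕ.* ∣ y i ∣      ≤⟨ ℕP.*-monoʳ-≤ ∣ a ∣ (small i) ⟩
  ∣ a ∣ ℕ.* m            ∎
  where open ℕP.≤-Reasoning

ambient-root-bound : ∀ m t (y : Fin (ambT t) → ℤ) → (∀ j → ∣ y j ∣ ℕ.≤ m) →
  ∀ β → AmbientRoot t β → ∣ ⟪ y , β ⟫ ∣ ℕ.≤ m ℕ.+ m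
ambient-root-bound m (A r) y small β root        = typeA-bound m y β small root
ambient-root-bound m (B r) y small β (inj₁ root) =
  ℕP.≤-trans (oneIndex-bound m (+ 1) y β small root) (ℕP.+-monoʳ-≤ m ℕ.z≤n)
ambient-root-bound m (B r) y small β (inj₂ root) = twoIndex-bound m y β small root
ambient-root-bound m (C r) y small β (inj₁ root) =
  ℕP.≤-trans (oneIndex-bound m (+ 2) y β small root) (ℕP.≤-reflexive (cong (m ℕ.+_) (ℕP.+-identityʳ m)))
ambient-root-bound m (C r) y small β (inj₂ root) = twoIndex-bound m y β small root
ambient-root-bound m (D r) y small β root        = twoIndex-bound m y β small root

-- a vector of length n as a sequence (zero beyond n)
toSeq : ∀ {n} → (Fin n → ℤ) → ℕ → ℤ
toSeq {zero}  w _       = + 0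
toSeq {suc n} w zero    = w fzero
toSeq {suc n} w (suc a) = toSeq (w ∘ fsuc) a

restrict-toSeq : ∀ {n} (w : Fin n → ℤ) k → restrict (toSeq w) k ≡ w k
restrict-toSeq w fzero    = refl
restrict-toSeq w (fsuc k) = restrict-toSeq (w ∘ fsuc) k

-- 2(m+1) = 1 + q for q = 2m+1, so 2(m+1) is inverse to 2 modulo q
double-succ : ∀ m → + 2 * + suc m ≡ + 1 + + suc (2 ℕ.* m)
double-succ m = cong (λ n → + suc n) (ℕP.+-suc m (m ℕ.+ 0))

solve-for : ∀ Q a b c → a + Q * b ≡ (+ 1 + Q) * c → a ≡ c + Q * (c - b)
solve-for Q a b c eq = trans (sym (cancel a Q b)) (trans (cong (_- Q * b) eq) (regroup Q c b))
  where
  cancel : ∀ a Q b → a + Q * b - Q * b ≡ a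
  cancel = solve-∀
  regroup : ∀ Q c b → (+ 1 + Q) * c - Q * b ≡ c + Q * (c - b)
  regroup = solve-∀

-- Take X with ⟨X, α_k⟩ = 2(m+1) w_k ≡ w_k and reduce its coordinates
-- symmetrically modulo q.
small-lift : ∀ m t → ValidType t → (w : Fin (rankT t) → ℤ) →
  Σ (Fin (ambT t) → ℤ) λ y → (∀ j → ∣ y j ∣ ℕ.≤ m) ×
  Σ (Fin (rankT t) → ℤ) λ z → ∀ k → ⟪ y , simpleRoot t k ⟫ ≡ w k + + suc (2 ℕ.* m) * z k
small-lift m t valid w = restrict Y , (λ j → Y-small (toℕ j)) , z , y·α≡w+Qz
  where
  Q : ℤ
  Q = + suc (2 ℕ.* m)
  lifted : Σ (ℕ → ℤ) λ X → ∀ k → simplePairing t X k ≡ + 2 * (+ suc m * toSeq w (toℕ k))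
  lifted = prescribe t valid (λ n → + suc m * toSeq w n)
  X : ℕ → ℤ
  X = proj₁ lifted
  Y Quot : ℕ → ℤ
  Y n = proj₁ (symmetric-residue m (X n))
  Quot n = proj₁ (proj₂ (symmetric-residue m (X n)))
  X≡Y+Q·Quot : ∀ n → X n ≡ Y n + Q * Quot n
  X≡Y+Q·Quot n = proj₁ (proj₂ (proj₂ (symmetric-residue m (X n))))
  Y-small : ∀ n → ∣ Y n ∣ ℕ.≤ m
  Y-small n = proj₂ (proj₂ (proj₂ (symmetric-residue m (X n))))
  y d : Fin (ambT t) → ℤ
  y = restrict Y
  d = restrict Quot
  z : Fin (rankT t) → ℤ
  z k = w k - ⟪ d , simpleRoot t k ⟫
  split : ∀ k → ⟪ y , simpleRoot t k ⟫ + Q * ⟪ d , simpleRoot t k ⟫ ≡ (+ 1 + Q) * w k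
  split k = begin
    ⟪ y , α ⟫ + Q * ⟪ d , α ⟫
      ≡⟨ sym (trans (pair-+ˡ y _ α) (cong (λ s → ⟪ y , α ⟫ + s) (pair-*ˡ Q d α))) ⟩
    ⟪ (λ j → y j + Q * d j) , α ⟫      ≡⟨ pair-congˡ α (λ j → sym (X≡Y+Q·Quot (toℕ j))) ⟩
    ⟪ restrict X , α ⟫                  ≡⟨ pair-simpleRoot t X k ⟩
    simplePairing t X k                 ≡⟨ proj₂ lifted k ⟩
    + 2 * (+ suc m * toSeq w (toℕ k))   ≡⟨ cong (λ a → + 2 * (+ suc m * a)) (restrict-toSeq w k) ⟩
    + 2 * (+ suc m * w k)               ≡⟨ sym (ℤP.*-assoc (+ 2) (+ suc m) (w k)) ⟩
    + 2 * + suc m * w k                 ≡⟨ cong (_* w k) (double-succ m) ⟩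
    (+ 1 + Q) * w k                     ∎
    where
    open ≡-Reasoning
    α : Fin (ambT t) → ℤ
    α = simpleRoot t k
  y·α≡w+Qz : ∀ k → ⟪ y , simpleRoot t k ⟫ ≡ w k + Q * z k
  y·α≡w+Qz k = solve-for Q _ _ (w k) (split k)

translate : ∀ {n} → ℕ → (Fin n → ℤ) → (Fin n → ℤ) → Fin n → ℤ
translate q w z k = w k + + q * z k

SmallOn : ∀ {n} → ((Fin n → ℤ) → Set) → ℕ → (Fin n → ℤ) → (Fin n → ℤ) → Set
SmallOn Root q w z = ∀ α → Root α → ∣ ⟪ translate q w z , α ⟫ ∣ ℕ.< q

irr-small-representative : ∀ m t → ValidType t → (w : Fin (rankT t) → ℤ) →
  Σ (Fin (rankT t) → ℤ) (SmallOn (IsRootIrr t) (suc (2 ℕ.* m)) w)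
irr-small-representative m t valid w =
  let (y , y-small , z , y·α≡w+Qz) = small-lift m t valid w in
  z , λ c root → begin-strict
    ∣ ⟪ translate (suc (2 ℕ.* m)) w z , c ⟫ ∣
      ≡⟨ cong ∣_∣ (trans (pair-congˡ c (sym ∘ y·α≡w+Qz)) (sym (pair-combine t y c))) ⟩
    ∣ ⟪ y , combine t c ⟫ ∣  ≤⟨ ambient-root-bound m t y y-small (combine t c) root ⟩
    m ℕ.+ m                  <⟨ s≤s (ℕP.≤-reflexive (cong (m ℕ.+_) (sym (ℕP.+-identityʳ m)))) ⟩
    suc (2 ℕ.* m)            ∎
  where open ℕP.≤-Reasoning

HasDual : ∀ {n} → (Fin n → ℤ) → Set
HasDual {n} α = Σ (Fin n → ℤ) λ g → ⟪ g , α ⟫ ≡ + 1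

-- Every root α has an integral dual vector g with ⟨g, α⟩ = 1.  In the
-- irreducible case it suffices to find an ambient y with ⟨y, β⟩ = 1 for the
-- ambient root β, and pull it back along the simple roots.
dual-from-ambient : ∀ t (c : Fin (rankT t) → ℤ) →
  HasDual (combine t c) → HasDual c
dual-from-ambient t c (y , y·β≡1) =
  (λ k → ⟪ y , simpleRoot t k ⟫) , trans (sym (pair-combine t y c)) y·β≡1

sign-square : ∀ {s} → Sgn s → s * s ≡ + 1
sign-square (inj₁ refl) = refl
sign-square (inj₂ refl) = refl

typeA-dual : ∀ {n} (β : Fin n → ℤ) →
  (Σ (Fin n) λ i → Σ (Fin n) λ j → i ≢ j × (∀ x → β x ≡ e i x - e j x)) → HasDual β
typeA-dual β (i , j , i≢j , β≡) =
  e i , trans (pair-typeA (e i) β i j β≡) (cong₂ _-_ (e-diag i) (e-off i j i≢j))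

twoIndex-dual : ∀ {n} (β : Fin n → ℤ) → TwoIndex β → HasDual β
twoIndex-dual β (i , j , i≢j , s , s' , sgn , _ , β≡) = (λ x → s * e i x) , y·β≡1
  where
  y·β≡1 : ⟪ (λ x → s * e i x) , β ⟫ ≡ + 1
  y·β≡1 = begin
    ⟪ (λ x → s * e i x) , β ⟫       ≡⟨ pair-twoIndex (λ x → s * e i x) β i j s s' β≡ ⟩
    s * (s * e i i) + s' * (s * e i j)
                                    ≡⟨ cong₂ (λ a b → s * (s * a) + s' * (s * b)) (e-diag i) (e-off i j i≢j) ⟩
    s * (s * + 1) + s' * (s * + 0)  ≡⟨ simplify s s' ⟩
    s * s                           ≡⟨ sign-square sgn ⟩
    + 1                             ∎
    where
    open ≡-Reasoning
    simplify : ∀ s s' → s * (s * + 1) + s' * (s * + 0) ≡ s * s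
    simplify = solve-∀

unitIndex-dual : ∀ {n} (β : Fin n → ℤ) → OneIndex (+ 1) β → HasDual β
unitIndex-dual β (i , s , sgn , β≡) = (λ x → s * e i x) , y·β≡1
  where
  y·β≡1 : ⟪ (λ x → s * e i x) , β ⟫ ≡ + 1
  y·β≡1 = begin
    ⟪ (λ x → s * e i x) , β ⟫   ≡⟨ pair-oneIndex (λ x → s * e i x) β i s (+ 1) β≡ ⟩
    s * (+ 1 * (s * e i i))     ≡⟨ cong (λ a → s * (+ 1 * (s * a))) (e-diag i) ⟩
    s * (+ 1 * (s * + 1))       ≡⟨ simplify s ⟩
    s * s                       ≡⟨ sign-square sgn ⟩
    + 1                         ∎
    where
    open ≡-Reasoning
    simplify : ∀ s → s * (+ 1 * (s * + 1)) ≡ s * s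
    simplify = solve-∀

-- The long roots ±2e_i of C_r: ⟨1, α_k⟩ = 2·[k is the last simple root], so
-- the indicator G of the last simple root satisfies 2⟨G, c⟩ = ⟨1, ±2e_i⟩ = ±2.
longC-dual : ∀ r (c : Fin r → ℤ) → OneIndex (+ 2) (combine (C r) c) → HasDual c
longC-dual r c (i , s , sgn , β≡) =
  (λ k → s * G k) , trans (pair-*ˡ s G c) (trans (cong (s *_) G·c≡s) (sign-square sgn))
  where
  G : Fin r → ℤ
  G k = if ⌊ suc (toℕ k) ℕ.<? r ⌋ then + 0 else + 1
  one : Fin r → ℤ
  one _ = + 1
  one·α≡2G : ∀ k → ⟪ one , simpleRoot (C r) k ⟫ ≡ + 2 * G k
  one·α≡2G k = trans (pair-simpleRoot (C r) (λ _ → + 1) k) (by-cases (suc (toℕ k) ℕ.<? r))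
    where
    by-cases : (d : Dec (suc (toℕ k) ℕ.< r)) →
      (if ⌊ d ⌋ then + 1 - + 1 else + 2 * + 1) ≡ + 2 * (if ⌊ d ⌋ then + 0 else + 1)
    by-cases (yes _) = refl
    by-cases (no _)  = refl
  2G·c≡2s : + 2 * ⟪ G , c ⟫ ≡ + 2 * s
  2G·c≡2s = begin
    + 2 * ⟪ G , c ⟫                                 ≡⟨ sym (pair-*ˡ (+ 2) G c) ⟩
    ⟪ (λ k → + 2 * G k) , c ⟫                       ≡⟨ pair-congˡ c (sym ∘ one·α≡2G) ⟩
    ⟪ (λ k → ⟪ one , simpleRoot (C r) k ⟫) , c ⟫    ≡⟨ sym (pair-combine (C r) one c) ⟩
    ⟪ one , combine (C r) c ⟫                       ≡⟨ pair-oneIndex one (combine (C r) c) i s (+ 2) β≡ ⟩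
    s * (+ 2 * + 1)                                 ≡⟨ ℤP.*-comm s (+ 2) ⟩
    + 2 * s                                         ∎
    where open ≡-Reasoning
  G·c≡s : ⟪ G , c ⟫ ≡ s
  G·c≡s = ℤP.*-cancelˡ-≡ (+ 2) _ _ 2G·c≡2s

irr-root-dual : ∀ t (c : Fin (rankT t) → ℤ) → IsRootIrr t c → HasDual c
irr-root-dual (A r) c root        = dual-from-ambient (A r) c (typeA-dual (combine (A r) c) root)
irr-root-dual (B r) c (inj₁ root) = dual-from-ambient (B r) c (unitIndex-dual (combine (B r) c) root)
irr-root-dual (B r) c (inj₂ root) = dual-from-ambient (B r) c (twoIndex-dual (combine (B r) c) root)
irr-root-dual (C r) c (inj₁ root) = longC-dual r c root
irr-root-dual (C r) c (inj₂ root) = dual-from-ambient (C r) c (twoIndex-dual (combine (C r) c) root)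
irr-root-dual (D r) c root        = dual-from-ambient (D r) c (twoIndex-dual (combine (D r) c) root)

-- Direct sums Φ₁ ⊕ Φ₂: N = ℤ^{m+n} splits into two blocks, and a root of
-- one summand vanishes on the other block, so pairings only see one block.
join : ∀ {m n} → (Fin m → ℤ) → (Fin n → ℤ) → Fin (m ℕ.+ n) → ℤ
join {m} a b k = [ a , b ]′ (Fin.splitAt m k)

join-left : ∀ {m n} (a : Fin m → ℤ) (b : Fin n → ℤ) j → join a b (j ↑ˡ n) ≡ a j
join-left {m} {n} a b j = cong [ a , b ]′ (FinP.splitAt-↑ˡ m j n)

join-right : ∀ {m n} (a : Fin m → ℤ) (b : Fin n → ℤ) j → join a b (m ↑ʳ j) ≡ b j
join-right {m} {n} a b j = cong [ a , b ]′ (FinP.splitAt-↑ʳ m n j)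

pair-left-block : ∀ m {n} (x α : Fin (m ℕ.+ n) → ℤ) → (∀ j → α (m ↑ʳ j) ≡ + 0) →
  ⟪ x , α ⟫ ≡ ⟪ x ∘ (_↑ˡ n) , α ∘ (_↑ˡ n) ⟫
pair-left-block m {n} x α right≡0 =
  trans (sum-split m (λ k → x k * α k))
        (trans (cong (λ s → ⟪ x ∘ (_↑ˡ n) , α ∘ (_↑ˡ n) ⟫ + s)
                     (pair-zeroʳ (x ∘ (m ↑ʳ_)) (α ∘ (m ↑ʳ_)) right≡0))
               (ℤP.+-identityʳ _))

pair-right-block : ∀ m {n} (x α : Fin (m ℕ.+ n) → ℤ) → (∀ j → α (j ↑ˡ n) ≡ + 0) →
  ⟪ x , α ⟫ ≡ ⟪ x ∘ (m ↑ʳ_) , α ∘ (m ↑ʳ_) ⟫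
pair-right-block m {n} x α left≡0 =
  trans (sum-split m (λ k → x k * α k))
        (trans (cong (_+ ⟪ x ∘ (m ↑ʳ_) , α ∘ (m ↑ʳ_) ⟫)
                     (pair-zeroʳ (x ∘ (_↑ˡ n)) (α ∘ (_↑ˡ n)) left≡0))
               (ℤP.+-identityˡ _))

join-small : ∀ {q t ts} (w : Fin (rankT t ℕ.+ rank ts) → ℤ) →
  Σ (Fin (rankT t) → ℤ) (SmallOn (IsRootIrr t) q (w ∘ (_↑ˡ rank ts))) →
  Σ (Fin (rank ts) → ℤ) (SmallOn (IsRoot ts) q (w ∘ (rankT t ↑ʳ_))) →
  Σ (Fin (rank (t ∷ ts)) → ℤ) (SmallOn (IsRoot (t ∷ ts)) q w)
join-small {q} {t} {ts} w (z₁ , small₁) (z₂ , small₂) = join z₁ z₂ , small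
  where
  x : Fin (rankT t ℕ.+ rank ts) → ℤ
  x = translate q w (join z₁ z₂)
  small : SmallOn (IsRoot (t ∷ ts)) q w (join z₁ z₂)
  small α (inj₁ (root , right≡0)) = subst (λ N → ∣ N ∣ ℕ.< q) (sym on-left) (small₁ _ root)
    where
    on-left : ⟪ x , α ⟫ ≡ ⟪ translate q (w ∘ (_↑ˡ rank ts)) z₁ , α ∘ (_↑ˡ rank ts) ⟫
    on-left = trans (pair-left-block (rankT t) x α right≡0)
      (pair-congˡ (α ∘ (_↑ˡ rank ts))
                  (λ j → cong (λ a → w (j ↑ˡ rank ts) + + q * a) (join-left z₁ z₂ j)))
  small α (inj₂ (left≡0 , root)) = subst (λ N → ∣ N ∣ ℕ.< q) (sym on-right) (small₂ _ root)
    where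
    on-right : ⟪ x , α ⟫ ≡ ⟪ translate q (w ∘ (rankT t ↑ʳ_)) z₂ , α ∘ (rankT t ↑ʳ_) ⟫
    on-right = trans (pair-right-block (rankT t) x α left≡0)
      (pair-congˡ (α ∘ (rankT t ↑ʳ_))
                  (λ j → cong (λ a → w (rankT t ↑ʳ j) + + q * a) (join-right z₁ z₂ j)))

small-representative : ∀ m ts → AllValid ts → (w : Fin (rank ts) → ℤ) →
  Σ (Fin (rank ts) → ℤ) (SmallOn (IsRoot ts) (suc (2 ℕ.* m)) w)
small-representative m []       _              w = w , λ _ ()
small-representative m (t ∷ ts) (valid , rest) w = join-small w
  (irr-small-representative m t valid (w ∘ (_↑ˡ rank ts)))
  (small-representative m ts rest (w ∘ (rankT t ↑ʳ_)))

root-dual : ∀ ts (α : Fin (rank ts) → ℤ) → IsRoot ts α → HasDual α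
root-dual (t ∷ ts) α (inj₁ (root , right≡0)) =
  let (g , g·α≡1) = irr-root-dual t (α ∘ (_↑ˡ rank ts)) root
      ĝ = join g (λ _ → + 0)
  in ĝ , trans (pair-left-block (rankT t) ĝ α right≡0)
               (trans (pair-congˡ (α ∘ (_↑ˡ rank ts)) (join-left g (λ _ → + 0))) g·α≡1)
root-dual (t ∷ ts) α (inj₂ (left≡0 , root)) =
  let (g , g·α≡1) = root-dual ts (α ∘ (rankT t ↑ʳ_)) root
      ĝ = join {rankT t} (λ _ → + 0) g
  in ĝ , trans (pair-right-block (rankT t) ĝ α left≡0)
               (trans (pair-congˡ (α ∘ (rankT t ↑ʳ_)) (join-right {rankT t} (λ _ → + 0) g)) g·α≡1)

-- The embedding ι : ℤ → ℚ is an injective ring homomorphism.  Equalities of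
-- rationals are checked on unnormalised representatives.
toℚᵘ-/ : ∀ a n → ℚ.toℚᵘ (a ℚ./ suc n) ℚᵘ.≃ mkℚᵘ a n
toℚᵘ-/ a n = ℚP.toℚᵘ-fromℚᵘ (mkℚᵘ a n)

via-ℚᵘ : ∀ {x y : ℚ} {p : ℚᵘ.ℚᵘ} → ℚ.toℚᵘ x ℚᵘ.≃ p → ℚ.toℚᵘ y ℚᵘ.≃ p → x ≡ y
via-ℚᵘ x≃p y≃p = ℚP.toℚᵘ-injective (ℚᵘP.≃-trans x≃p (ℚᵘP.≃-sym y≃p))

ι-+ : ∀ a b → ι (a + b) ≡ ι a ℚ.+ ι b
ι-+ a b = via-ℚᵘ (toℚᵘ-/ (a + b) 0)
  (ℚᵘP.≃-trans (ℚP.toℚᵘ-homo-+ (ι a) (ι b))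
  (ℚᵘP.≃-trans (ℚᵘP.+-cong (toℚᵘ-/ a 0) (toℚᵘ-/ b 0)) (*≡* (cross-multiply a b))))
  where
  cross-multiply : ∀ a b → (a * + 1 + b * + 1) * + 1 ≡ (a + b) * + 1
  cross-multiply = solve-∀

ι-* : ∀ a b → ι (a * b) ≡ ι a ℚ.* ι b
ι-* a b = via-ℚᵘ (toℚᵘ-/ (a * b) 0)
  (ℚᵘP.≃-trans (ℚP.toℚᵘ-homo-* (ι a) (ι b))
  (ℚᵘP.≃-trans (ℚᵘP.*-cong (toℚᵘ-/ a 0) (toℚᵘ-/ b 0)) (*≡* refl)))

ι-injective : ∀ {a b} → ι a ≡ ι b → a ≡ b
ι-injective {a} {b} ιa≡ιb
  with ℚᵘP.≃-trans (ℚᵘP.≃-sym (toℚᵘ-/ a 0)) (ℚᵘP.≃-trans (ℚP.toℚᵘ-cong ιa≡ιb) (toℚᵘ-/ b 0))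
... | *≡* a1≡b1 = trans (sym (ℤP.*-identityʳ a)) (trans a1≡b1 (ℤP.*-identityʳ b))

sumℚ-cong : ∀ {n} {f g : Fin n → ℚ} → (∀ j → f j ≡ g j) → sumℚ f ≡ sumℚ g
sumℚ-cong {zero}  f≗g = refl
sumℚ-cong {suc n} f≗g = cong₂ ℚ._+_ (f≗g fzero) (sumℚ-cong (f≗g ∘ fsuc))

sumℚ-*ʳ : ∀ {n} (f : Fin n → ℚ) c → sumℚ f ℚ.* c ≡ sumℚ (λ j → f j ℚ.* c)
sumℚ-*ʳ {zero}  f c = ℚP.*-zeroˡ c
sumℚ-*ʳ {suc n} f c = trans (ℚP.*-distribʳ-+ c (f fzero) (sumℚ (f ∘ fsuc)))
  (cong (λ s → f fzero ℚ.* c ℚ.+ s) (sumℚ-*ʳ (f ∘ fsuc) c))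

ι-pair : ∀ {n} (x v : Fin n → ℤ) → ι ⟪ x , v ⟫ ≡ sumℚ (λ j → ι (x j) ℚ.* ι (v j))
ι-pair {zero}  x v = refl
ι-pair {suc n} x v = trans (ι-+ (x fzero * v fzero) ⟪ x ∘ fsuc , v ∘ fsuc ⟫)
  (cong₂ ℚ._+_ (ι-* (x fzero) (v fzero)) (ι-pair (x ∘ fsuc) (v ∘ fsuc)))

-- A primitive vector v that is a rational multiple t·α of a vector α with an
-- integral dual g (⟨g, α⟩ = 1) is ±α: T = ⟨g, v⟩ equals t, so v = Tα and the
-- integer |T| divides every coordinate of v.
primitive-multiple : ∀ {n} (v α : Fin n → ℤ) (t : ℚ) → Primitive v →
  (∀ j → ι (v j) ≡ t ℚ.* ι (α j)) → HasDual α →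
  Σ ℤ λ T → ∣ T ∣ ≡ 1 × (∀ j → v j ≡ T * α j)
primitive-multiple v α t v-primitive v≡tα (g , g·α≡1) = T , ∣T∣≡1 , v≡Tα
  where
  open +-*-Solver
  T : ℤ
  T = ⟪ g , v ⟫
  ιT≡t : ι T ≡ t
  ιT≡t = begin
    ι ⟪ g , v ⟫                                 ≡⟨ ι-pair g v ⟩
    sumℚ (λ j → ι (g j) ℚ.* ι (v j))            ≡⟨ sumℚ-cong (λ j → cong (ι (g j) ℚ.*_) (v≡tα j)) ⟩
    sumℚ (λ j → ι (g j) ℚ.* (t ℚ.* ι (α j)))    ≡⟨ sumℚ-cong (λ j → rearrange (ι (g j)) t (ι (α j))) ⟩
    sumℚ (λ j → ι (g j) ℚ.* ι (α j) ℚ.* t)      ≡⟨ sym (sumℚ-*ʳ (λ j → ι (g j) ℚ.* ι (α j)) t) ⟩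
    sumℚ (λ j → ι (g j) ℚ.* ι (α j)) ℚ.* t      ≡⟨ cong (ℚ._* t) (sym (ι-pair g α)) ⟩
    ι ⟪ g , α ⟫ ℚ.* t                           ≡⟨ cong (λ a → ι a ℚ.* t) g·α≡1 ⟩
    ℚ.1ℚ ℚ.* t                                  ≡⟨ ℚP.*-identityˡ t ⟩
    t                                           ∎
    where
    open ≡-Reasoning
    rearrange : ∀ a t b → a ℚ.* (t ℚ.* b) ≡ a ℚ.* b ℚ.* t
    rearrange = solve 3 (λ a t b → a :* (t :* b) := a :* b :* t) refl
  v≡Tα : ∀ j → v j ≡ T * α j
  v≡Tα j = ι-injective (trans (v≡tα j) (trans (cong (ℚ._* ι (α j)) (sym ιT≡t)) (sym (ι-* T (α j)))))
  ∣T∣≡1 : ∣ T ∣ ≡ 1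
  ∣T∣≡1 = v-primitive ∣ T ∣ λ j →
    subst (∣ T ∣ ℕDiv.∣_) (sym (trans (cong ∣_∣ (v≡Tα j)) (ℤP.abs-* T (α j)))) (ℕDiv.m∣m*n ∣ α j ∣)

reciprocal : ℕ → ℚ
reciprocal n = + 1 ℚ./ suc n

divide-as-product : ∀ n a → a ℚ./ suc n ≡ ι a ℚ.* reciprocal n
divide-as-product n a = via-ℚᵘ (toℚᵘ-/ a n)
  (ℚᵘP.≃-trans (ℚP.toℚᵘ-homo-* (ι a) (reciprocal n))
  (ℚᵘP.≃-trans (ℚᵘP.*-cong (toℚᵘ-/ a 0) (toℚᵘ-/ (+ 1) n))
    (*≡* (trans (cong (_* + suc n) (ℤP.*-identityʳ a))
                (cong (λ x → a * + suc x) (sym (ℕP.+-identityʳ n)))))))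

times-reciprocal : ∀ n → ι (+ suc n) ℚ.* reciprocal n ≡ ℚ.1ℚ
times-reciprocal n = trans (sym (divide-as-product n (+ suc n)))
  (via-ℚᵘ (toℚᵘ-/ (+ suc n) n) (*≡* (ℤP.*-comm (+ 1) (+ suc n))))

translate-coordinate : ∀ n w z → (w ℚ./ suc n) ℚ.+ ι z ≡ ι (w + + suc n * z) ℚ.* reciprocal n
translate-coordinate n w z = begin
  (w ℚ./ suc n) ℚ.+ ι z                        ≡⟨ cong₂ ℚ._+_ (divide-as-product n w) (sym one·z) ⟩
  ι w ℚ.* r ℚ.+ (ι q ℚ.* r) ℚ.* ι z            ≡⟨ factor (ι w) (ι q) (ι z) r ⟩
  (ι w ℚ.+ ι q ℚ.* ι z) ℚ.* r
    ≡⟨ cong (ℚ._* r) (sym (trans (ι-+ w (q * z)) (cong (ι w ℚ.+_) (ι-* q z)))) ⟩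
  ι (w + q * z) ℚ.* r                          ∎
  where
  open ≡-Reasoning
  open +-*-Solver
  q : ℤ
  q = + suc n
  r : ℚ
  r = reciprocal n
  one·z : (ι q ℚ.* r) ℚ.* ι z ≡ ι z
  one·z = trans (cong (ℚ._* ι z) (times-reciprocal n)) (ℚP.*-identityˡ (ι z))
  factor : ∀ a b c d → a ℚ.* d ℚ.+ (b ℚ.* d) ℚ.* c ≡ (a ℚ.+ b ℚ.* c) ℚ.* d
  factor = solve 4 (λ a b c d → a :* d :+ (b :* d) :* c := (a :+ b :* c) :* d) refl

pairing-translate : ∀ n {k} (w z v : Fin k → ℤ) →
  ⟪ (λ j → (w j ℚ./ suc n) ℚ.+ ι (z j)) , v ⟫ℚ ≡ ⟪ translate (suc n) w z , v ⟫ ℚ./ suc n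
pairing-translate n {k} w z v = begin
  sumℚ (λ j → ((w j ℚ./ suc n) ℚ.+ ι (z j)) ℚ.* ι (v j))
    ≡⟨ sumℚ-cong (λ j → cong (ℚ._* ι (v j)) (translate-coordinate n (w j) (z j))) ⟩
  sumℚ (λ j → ι (x j) ℚ.* r ℚ.* ι (v j))
    ≡⟨ sumℚ-cong (λ j → swap (ι (x j)) r (ι (v j))) ⟩
  sumℚ (λ j → ι (x j) ℚ.* ι (v j) ℚ.* r)
    ≡⟨ sym (sumℚ-*ʳ (λ j → ι (x j) ℚ.* ι (v j)) r) ⟩
  sumℚ (λ j → ι (x j) ℚ.* ι (v j)) ℚ.* r
    ≡⟨ cong (ℚ._* r) (sym (ι-pair x v)) ⟩
  ι ⟪ x , v ⟫ ℚ.* r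
    ≡⟨ sym (divide-as-product n ⟪ x , v ⟫) ⟩
  ⟪ x , v ⟫ ℚ./ suc n ∎
  where
  open ≡-Reasoning
  open +-*-Solver
  x : Fin k → ℤ
  x = translate (suc n) w z
  r : ℚ
  r = reciprocal n
  swap : ∀ a b c → a ℚ.* b ℚ.* c ≡ a ℚ.* c ℚ.* b
  swap = solve 3 (λ a b c → a :* b :* c := a :* c :* b) refl

abs<⇒bounds : ∀ {q} N → ∣ N ∣ ℕ.< suc q → - + suc q ℤ.< N × N ℤ.< + suc q
abs<⇒bounds (+ n)    n<q       = ℤ.-<+ , ℤ.+<+ n<q
abs<⇒bounds -[1+ n ] n+1<q+1   = ℤ.-<- (ℕP.≤-pred n+1<q+1) , ℤ.-<+

abs<⇒unit-interval : ∀ n N → ∣ N ∣ ℕ.< suc n →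
  (ℚ.- ℚ.1ℚ) ℚ.< N ℚ./ suc n × N ℚ./ suc n ℚ.< ℚ.1ℚ
abs<⇒unit-interval n N ∣N∣<q with abs<⇒bounds N ∣N∣<q
... | -q<N , N<q =
  ℚP.toℚᵘ-cancel-< (ℚᵘP.<-respʳ-≃ (ℚᵘP.≃-sym (toℚᵘ-/ N n))
    (*<* (subst₂ ℤ._<_ (sym (ℤP.-1*i≡-i (+ suc n))) (sym (ℤP.*-identityʳ N)) -q<N))) ,
  ℚP.toℚᵘ-cancel-< (ℚᵘP.<-respˡ-≃ (ℚᵘP.≃-sym (toℚᵘ-/ N n))
    (*<* (subst₂ ℤ._<_ (sym (ℤP.*-identityʳ N)) (sym (ℤP.*-identityˡ (+ suc n))) N<q)))

pair-unit-multiple : ∀ {n} (x v α : Fin n → ℤ) (T : ℤ) → ∣ T ∣ ≡ 1 → (∀ j → v j ≡ T * α j) →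
  ∣ ⟪ x , v ⟫ ∣ ≡ ∣ ⟪ x , α ⟫ ∣
pair-unit-multiple x v α T ∣T∣≡1 v≡Tα = begin
  ∣ ⟪ x , v ⟫ ∣              ≡⟨ cong ∣_∣ (trans (pair-congʳ x v≡Tα) (pair-*ʳ T x α)) ⟩
  ∣ T * ⟪ x , α ⟫ ∣          ≡⟨ ℤP.abs-* T ⟪ x , α ⟫ ⟩
  ∣ T ∣ ℕ.* ∣ ⟪ x , α ⟫ ∣    ≡⟨ cong (ℕ._* ∣ ⟪ x , α ⟫ ∣) ∣T∣≡1 ⟩
  1 ℕ.* ∣ ⟪ x , α ⟫ ∣        ≡⟨ ℕP.*-identityˡ _ ⟩
  ∣ ⟪ x , α ⟫ ∣              ∎
  where open ≡-Reasoning

-- If P is cut out by Φ and z is a small representative of w for q, then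
-- u = w/q + z lies in the interior of F_P: each facet normal is v = ±α for a
-- root α, so ⟨u, v⟩ = ±⟨w + qz, α⟩/q ∈ (-1, 1).
small-representative-interior : ∀ ts (S : List (Fin (rank ts) → ℤ)) → CutOutBy ts S →
  ∀ n (w z : Fin (rank ts) → ℤ) → SmallOn (IsRoot ts) (suc n) w z →
  InInteriorF S (λ j → (w j ℚ./ suc n) ℚ.+ ι (z j))
small-representative-interior ts S cut n w z small v facet =
  let (α , root , t , v≡tα) = cut v facet
      (T , ∣T∣≡1 , v≡Tα) = primitive-multiple v α t (proj₁ facet) v≡tα (root-dual ts α root)
      x = translate (suc n) w z
      ∣x·v∣<q = subst (ℕ._< suc n) (sym (pair-unit-multiple x v α T ∣T∣≡1 v≡Tα)) (small α root)
  in subst (λ a → (ℚ.- ℚ.1ℚ) ℚ.< a × a ℚ.< ℚ.1ℚ) (sym (pairing-translate n w z v))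
           (abs<⇒unit-interval n ⟪ x , v ⟫ ∣x·v∣<q)

proposition3p3 : (ts : List RootType) → AllValid ts →
    (S : List (Fin (rank ts) → ℤ)) → FullDim S → CutOutBy ts S →
    (q : ℕ) → .{{_ : NonZero q}} → 3 ≤ q → Odd q → DiagonallySplit S q
proposition3p3 ts valid S _ cut .(suc (2 ℕ.* m)) _ (m , refl) w =
  let (z , small) = small-representative m ts valid w in
  z , small-representative-interior ts S cut (2 ℕ.* m) w z small
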